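{- Let $G$ be a finite simple graph that is the complement of a bipartite graph, and let $b$ be a positive integer. Then $\varphi(G)=b$ if and only if $\max\{k : G\in\mathcal{A}_k\}=b$.
   Context: A $b$-coloring of $G$ with $b$ colors is a proper coloring of $V(G)$ using exactly $b$ colors such that for every color $i$ there is a vertex of color $i$ having neighbors of all the other $b-1$ colors. The $b$-chromatic number $\varphi(G)$ is the largest $b$ for which such a coloring exists. An antimatching between disjoint vertex sets $S,T$ of $G$ is a matching between $S$ and $T$ in the complement $\overline{G}$; it is perfect if it covers all of $S\cup T$. The family $\mathcal{A}_k$ consists of all graphs $G$ that are complements of bipartite graphs for which there is a partition $V(G)=X\cup Y$ with $X$ and $Y$ each inducing a clique in $G$, together with partitions $X=A_1\cup B_1\cup C_1$ and $Y=A_2\cup B_2\cup C_2$ (parts possibly empty) such that: (1) every vertex of $A_1$ is adjacent to every vertex of $A_2\cup B_2$, and every vertex of $A_2$ is adjacent to every vertex of $C_1$; (2) $|B_1|=|B_2|$ and there is a perfect antimatching between $B_1$ and $B_2$; (3) $|C_1|=|C_2|$ and there is a perfect antimatching between $C_1$ and $C_2$; and $k=|X|+|A_2|$. -}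

module Defs where

open import Data.Nat using (ℕ; zero; suc; _+_; _≤_)
open import Data.Fin using (Fin; zero; suc)
open import Data.Sum using (_⊎_)
open import Data.Bool using (Bool; true; false; if_then_else_)
open import Data.Product using (Σ; ∃; _×_; _,_)
open import Relation.Binary.PropositionalEquality using (_≡_; _≢_)
open import Relation.Nullary using (¬_)

record Graph : Set where
  field
    n     : ℕ
    adj   : Fin n → Fin n → Bool
    sym   : ∀ u v → adj u v ≡ adj v u
    irrefl : ∀ v → adj v v ≡ false
open Graph public

Adj : (G : Graph) → Fin (n G) → Fin (n G) → Set
Adj G u v = adj G u v ≡ true

CoAdj : (G : Graph) → Fin (n G) → Fin (n G) → Set
CoAdj G u v = (u ≢ v) × (adj G u v ≡ false)

ComplementIsBipartite : Graph → Set
ComplementIsBipartite G =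
  Σ (Fin (n G) → Bool) λ side → ∀ u v → CoAdj G u v → side u ≢ side v

IsBColoring : (G : Graph) (b : ℕ) → (Fin (n G) → Fin b) → Set
IsBColoring G b c =
  (∀ u v → Adj G u v → c u ≢ c v)
  × (∀ (i : Fin b) → ∃ λ v → c v ≡ i)
  × (∀ (i : Fin b) → ∃ λ v → c v ≡ i ×
       (∀ (j : Fin b) → j ≢ i → ∃ λ u → Adj G v u × c u ≡ j))

HasBColoring : Graph → ℕ → Set
HasBColoring G b = Σ (Fin (n G) → Fin b) (IsBColoring G b)

BChromaticNumberIs : Graph → ℕ → Set
BChromaticNumberIs G b = HasBColoring G b × (∀ b′ → HasBColoring G b′ → b′ ≤ b)

count : ∀ {m} → (Fin m → Bool) → ℕ
count {zero} p = 0
count {suc m} p = (if p zero then 1 else 0) + count (λ i → p (suc i))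

data Part : Set where
  partA partB partC : Part

isA : Part → Bool
isA partA = true
isA partB = false
isA partC = false

PerfectAntimatching : (G : Graph) → (Fin (n G) → Set) → (Fin (n G) → Set) → Set
PerfectAntimatching G S T =
  Σ (Fin (n G) → Fin (n G)) λ m →
      (∀ x → S x → T (m x) × CoAdj G x (m x))
    × (∀ x x′ → S x → S x′ → m x ≡ m x′ → x ≡ x′)
    × (∀ y → T y → ∃ λ x → S x × m x ≡ y)

InA : Graph → ℕ → Set
InA G k =
  ComplementIsBipartite G ×
  Σ (Fin (n G) → Bool) λ inX →
  Σ (Fin (n G) → Part) λ part →
  let X : Part → Fin (n G) → Set
      X p v = (inX v ≡ true) × (part v ≡ p)
      Y : Part → Fin (n G) → Set
      Y p v = (inX v ≡ false) × (part v ≡ p)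
  in
    (∀ u v → u ≢ v → inX u ≡ inX v → Adj G u v)
    -- (1)
  × (∀ u v → X partA u → (Y partA v ⊎ Y partB v) → Adj G u v)
  × (∀ u v → Y partA u → X partC v → Adj G u v)
  × PerfectAntimatching G (X partB) (Y partB)
  × PerfectAntimatching G (X partC) (Y partC)
    -- k = |X| + |A₂|
  × k ≡ count inX + count (λ v → if inX v then false else isA (part v))

-- The complement of G being bipartite, every colour class of a proper colouring is
-- a clique of the complement: a single vertex, or an antimatched pair with one vertex
-- in X and one in Y. So the two sets of admissible k coincide:
--
-- * From G ∈ 𝒜_k, give the k vertices of X ∪ A₂ distinct colours and each vertex of
--   B₂ ∪ C₂ the colour of its antimate. The b-vertex of a class is its vertex in X if
--   the class meets A₁ ∪ C₁ (X is a clique and (1) joins A₂ to A₁ ∪ C₁), and its vertex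
--   in Y if the class meets A₂ ∪ B₁ (Y is a clique, every class except those of A₁
--   meets Y, and (1) joins A₁ to A₂ ∪ B₂).
--
-- * From a b-colouring, singleton classes form A, and a pair goes to C if its b-vertex
--   lies in X and to B otherwise. A vertex of A is the only vertex of its colour, so it
--   is adjacent to every other b-vertex; as the vertices of A, B₂ and C₁ are b-vertices,
--   this gives (1). Choosing from each class its vertex in X, or its only vertex, shows
--   b = |X| + |A₂|.

{-# OPTIONS --safe #-}
module Submission where

open import Defs hiding (sym)
open import Data.Nat using (ℕ; zero; suc; _+_; _≤_)
open import Data.Nat.Properties using (+-commutativeSemigroup)
open import Algebra.Properties.CommutativeSemigroup +-commutativeSemigroup using (x∙yz≈y∙xz)
open import Data.Bool using (Bool; true; false; not; if_then_else_)
open import Data.Bool.Properties using (¬-not) renaming (_≟_ to _≟ᵇ_)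
open import Data.Fin using (Fin; zero; suc)
open import Data.Fin.Properties using (_≟_; any?; +↔⊎; cantor-schröder-bernstein)
open import Data.Product using (Σ; ∃; _×_; _,_; proj₁; proj₂)
open import Data.Sum using (_⊎_; inj₁; inj₂; [_,_])
open import Data.Sum.Function.Propositional using (_⊎-cong_)
open import Data.Empty using (⊥-elim)
open import Function using (_∘_)
open import Function.Bundles using (_⇔_; _↔_; Inverse; mk⇔; mk↔ₛ′)
import Function.Related.Propositional as Related
open import Axiom.UniquenessOfIdentityProofs using (module Decidable⇒UIP)
open import Relation.Nullary using (¬_; Dec; yes; no)
open import Relation.Nullary.Decidable using (_×-dec_; ¬?; decidable-stable)
open import Relation.Binary.PropositionalEquality using (_≡_; _≢_; refl; sym; trans; cong; subst; subst₂)

count-if : ∀ {m} (s q : Fin m → Bool) →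
  count (λ v → if s v then true else q v) ≡ count s + count (λ v → if s v then false else q v)
count-if {zero} s q = refl
count-if {suc m} s q with s zero
... | true  = cong suc (count-if (s ∘ suc) (q ∘ suc))
... | false = trans (cong ((if q zero then 1 else 0) +_) (count-if (s ∘ suc) (q ∘ suc)))
                    (x∙yz≈y∙xz (if q zero then 1 else 0) (count (s ∘ suc)) _)

Holds : ∀ {m} → (Fin m → Bool) → Set
Holds {m} p = Σ (Fin m) λ v → p v ≡ true

indicator↔ : ∀ b → Fin (if b then 1 else 0) ↔ (b ≡ true)
indicator↔ true  = mk↔ₛ′ (λ _ → refl) (λ _ → zero) (λ { refl → refl }) (λ { zero → refl })
indicator↔ false = mk↔ₛ′ (λ ()) (λ ()) (λ ()) (λ ())

⊎-Σ-Fin-suc↔ : ∀ {m} (P : Fin (suc m) → Set) → (P zero ⊎ Σ (Fin m) (P ∘ suc)) ↔ Σ (Fin (suc m)) P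
⊎-Σ-Fin-suc↔ P = mk↔ₛ′ to from to∘from from∘to
  where
  to : P zero ⊎ Σ _ (P ∘ suc) → Σ _ P
  to (inj₁ p)       = zero , p
  to (inj₂ (v , p)) = suc v , p
  from : Σ _ P → P zero ⊎ Σ _ (P ∘ suc)
  from (zero  , p) = inj₁ p
  from (suc v , p) = inj₂ (v , p)
  to∘from : ∀ x → to (from x) ≡ x
  to∘from (zero  , p) = refl
  to∘from (suc v , p) = refl
  from∘to : ∀ x → from (to x) ≡ x
  from∘to (inj₁ p) = refl
  from∘to (inj₂ p) = refl

count↔ : ∀ {m} (p : Fin m → Bool) → Fin (count p) ↔ Holds p
count↔ {zero}  p = mk↔ₛ′ (λ ()) (λ { (() , _) }) (λ { (() , _) }) (λ ())
count↔ {suc m} p =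
  Fin ((if p zero then 1 else 0) + count (p ∘ suc))       ↔⟨ +↔⊎ ⟩
  (Fin (if p zero then 1 else 0) ⊎ Fin (count (p ∘ suc))) ↔⟨ indicator↔ (p zero) ⊎-cong count↔ (p ∘ suc) ⟩
  (p zero ≡ true ⊎ Holds (p ∘ suc))                      ↔⟨ ⊎-Σ-Fin-suc↔ (λ v → p v ≡ true) ⟩
  Holds p                                                ∎
  where open Related.EquationalReasoning

module Enumeration {m} (p : Fin m → Bool) where
  open Inverse (count↔ p)
  open Decidable⇒UIP _≟ᵇ_ using (≡-irrelevant)

  select : Fin (count p) → Fin m
  select i = proj₁ (to i)

  select-holds : ∀ i → p (select i) ≡ true
  select-holds i = proj₂ (to i)

  index : ∀ v → p v ≡ true → Fin (count p)
  index v h = from (v , h)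

  index-select : ∀ i → index (select i) (select-holds i) ≡ i
  index-select = strictlyInverseʳ

  select-index : ∀ v h → select (index v h) ≡ v
  select-index v h = cong proj₁ (strictlyInverseˡ (v , h))

  index-cong : ∀ {u v} → u ≡ v → (h : p u ≡ true) (h′ : p v ≡ true) → index u h ≡ index v h′
  index-cong refl h h′ = cong (index _) (≡-irrelevant h h′)

  index-injective : ∀ {u v h h′} → index u h ≡ index v h′ → u ≡ v
  index-injective {u} {v} {h} {h′} e =
    trans (sym (select-index u h)) (trans (cong select e) (select-index v h′))

  select-injective : ∀ {i j} → select i ≡ select j → i ≡ j
  select-injective {i} {j} e =
    trans (sym (index-select i)) (trans (index-cong e _ (select-holds j)) (index-select j))

count-bijection : ∀ {m k} (p : Fin m → Bool) (f : Fin m → Fin k) →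
  (∀ {u v} → p u ≡ true → p v ≡ true → f u ≡ f v → u ≡ v) →
  (∀ j → ∃ λ v → p v ≡ true × f v ≡ j) → count p ≡ k
count-bijection {k = k} p f f-injective f-onto =
  cantor-schröder-bernstein {f = f ∘ select} {g = g}
    (λ e → select-injective (f-injective (select-holds _) (select-holds _) e))
    (λ {i} {j} e → trans (sym (f-select-g i)) (trans (cong (f ∘ select) e) (f-select-g j)))
  where
  open Enumeration p

  g : Fin k → Fin (count p)
  g j = index (proj₁ (f-onto j)) (proj₁ (proj₂ (f-onto j)))

  f-select-g : ∀ j → f (select (g j)) ≡ j
  f-select-g j = trans (cong f (select-index _ _)) (proj₂ (proj₂ (f-onto j)))

adj-sym : ∀ (G : Graph) {u v} → Adj G u v → Adj G v u
adj-sym G {u} {v} = trans (Graph.sym G v u)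

¬Adj-loop : ∀ (G : Graph) {v} → ¬ Adj G v v
¬Adj-loop G {v} a with () ← trans (sym (irrefl G v)) a

CoAdj⇒¬Adj : ∀ (G : Graph) {u v} → CoAdj G u v → ¬ Adj G u v
CoAdj⇒¬Adj G (_ , f) a with () ← trans (sym f) a

fibres⇒HasBColoring : (G : Graph) (S : Fin (n G) → Bool) (rep : Fin (n G) → Fin (n G)) →
  (∀ v → S (rep v) ≡ true) →
  (∀ v → S v ≡ true → rep v ≡ v) →
  (∀ u v → rep u ≡ rep v → ¬ Adj G u v) →
  (∀ x → S x ≡ true → ∃ λ d → rep d ≡ x ×
     (∀ y → S y ≡ true → y ≢ x → ∃ λ u → Adj G d u × rep u ≡ y)) →
  HasBColoring G (count S)
fibres⇒HasBColoring G S rep rep-∈ rep-id rep-independent rep-dominated =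
  colour , proper , (λ i → select i , colour-select i) , bVertex
  where
  open Enumeration S

  colour : Fin (n G) → Fin (count S)
  colour v = index (rep v) (rep-∈ v)

  colour-≡ : ∀ {v i} → rep v ≡ select i → colour v ≡ i
  colour-≡ {v} {i} e = trans (index-cong e (rep-∈ v) (select-holds i)) (index-select i)

  colour-select : ∀ i → colour (select i) ≡ i
  colour-select i = colour-≡ (rep-id _ (select-holds i))

  proper : ∀ u v → Adj G u v → colour u ≢ colour v
  proper u v a e = rep-independent u v (index-injective e) a

  bVertex : ∀ i → ∃ λ d → colour d ≡ i × (∀ j → j ≢ i → ∃ λ u → Adj G d u × colour u ≡ j)
  bVertex i with rep-dominated (select i) (select-holds i)
  ... | d , d↦i , dominated = d , colour-≡ d↦i , neighbour
    where
    neighbour : ∀ j → j ≢ i → ∃ λ u → Adj G d u × colour u ≡ j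
    neighbour j j≢i with dominated (select j) (select-holds j) (j≢i ∘ select-injective)
    ... | u , a , u↦j = u , a , colour-≡ u↦j

module Partition {m} (inX : Fin m → Bool) (part : Fin m → Part) where

  X Y : Part → Fin m → Set
  X q v = (inX v ≡ true) × (part v ≡ q)
  Y q v = (inX v ≡ false) × (part v ≡ q)

  X∪A₂ : Fin m → Bool
  X∪A₂ v = if inX v then true else isA (part v)

  count-X∪A₂ : count X∪A₂ ≡ count inX + count (λ v → if inX v then false else isA (part v))
  count-X∪A₂ = count-if inX (isA ∘ part)

  X⊆X∪A₂ : ∀ {v} → inX v ≡ true → X∪A₂ v ≡ true
  X⊆X∪A₂ {v} e rewrite e = refl

  A⊆X∪A₂ : ∀ {v} → part v ≡ partA → X∪A₂ v ≡ true
  A⊆X∪A₂ {v} e with inX v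
  ... | true  = refl
  ... | false rewrite e = refl

  X∪A₂-false : ∀ {v} → X∪A₂ v ≡ false → inX v ≡ false × part v ≢ partA
  X∪A₂-false {v} e = ¬-not (not-true ∘ X⊆X∪A₂) , not-true ∘ A⊆X∪A₂
    where
    not-true : X∪A₂ v ≢ true
    not-true t with () ← trans (sym e) t

  X∪A₂-elim : ∀ {v} → X∪A₂ v ≡ true → inX v ≡ true ⊎ Y partA v
  X∪A₂-elim {v} s with inX v | part v
  ... | true  | _     = inj₁ refl
  ... | false | partA = inj₂ (refl , refl)

  Y∉X∪A₂ : ∀ {q v} → q ≢ partA → Y q v → X∪A₂ v ≢ true
  Y∉X∪A₂ q≢A (vY , vq) s with X∪A₂-elim s
  ... | inj₁ vX       with () ← trans (sym vX) vY
  ... | inj₂ (_ , vA) = q≢A (trans (sym vq) vA)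

  data Cell (v : Fin m) : Set where
    X-A : X partA v → Cell v
    X-B : X partB v → Cell v
    X-C : X partC v → Cell v
    Y-A : Y partA v → Cell v
    Y-B : Y partB v → Cell v
    Y-C : Y partC v → Cell v

  cell : ∀ v → Cell v
  cell v with inX v in x | part v in p
  ... | true  | partA = X-A (x , p)
  ... | true  | partB = X-B (x , p)
  ... | true  | partC = X-C (x , p)
  ... | false | partA = Y-A (x , p)
  ... | false | partB = Y-B (x , p)
  ... | false | partC = Y-C (x , p)

module Antimatching (G : Graph) {S T : Fin (n G) → Set} (M : PerfectAntimatching G S T) where

  mate : Fin (n G) → Fin (n G)
  mate = proj₁ M

  mate-∈ : ∀ {x} → S x → T (mate x)
  mate-∈ s = proj₁ (proj₁ (proj₂ M) _ s)

  mate-coAdj : ∀ {x} → S x → CoAdj G x (mate x)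
  mate-coAdj s = proj₂ (proj₁ (proj₂ M) _ s)

  mate-injective : ∀ {x x′} → S x → S x′ → mate x ≡ mate x′ → x ≡ x′
  mate-injective = proj₁ (proj₂ (proj₂ M)) _ _

  mate-onto : ∀ {y} → T y → ∃ λ x → S x × mate x ≡ y
  mate-onto = proj₂ (proj₂ (proj₂ M)) _

module 𝒜⇒BColoring (G : Graph) (inX : Fin (n G) → Bool) (part : Fin (n G) → Part) where
  open Partition inX part

  module _
    (clique : ∀ u v → u ≢ v → inX u ≡ inX v → Adj G u v)
    (A₁-adj : ∀ u v → X partA u → (Y partA v ⊎ Y partB v) → Adj G u v)
    (A₂-adj : ∀ u v → Y partA u → X partC v → Adj G u v)
    (PB : PerfectAntimatching G (X partB) (Y partB))
    (PC : PerfectAntimatching G (X partC) (Y partC))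
    where
    open Antimatching G PB renaming (mate to mB; mate-∈ to mB-∈; mate-coAdj to mB-coAdj;
                                   mate-injective to mB-injective; mate-onto to mB-onto)
    open Antimatching G PC renaming (mate to mC; mate-∈ to mC-∈; mate-coAdj to mC-coAdj;
                                   mate-injective to mC-injective; mate-onto to mC-onto)

    data Represents (x v : Fin (n G)) : Set where
      itself : x ≡ v → X∪A₂ v ≡ true → Represents x v
      B-mate : X partB x → mB x ≡ v → Represents x v
      C-mate : X partC x → mC x ≡ v → Represents x v

    represent : ∀ v → ∃ λ x → Represents x v
    represent v with cell v
    ... | X-A (x , _) = v , itself refl (X⊆X∪A₂ x)
    ... | X-B (x , _) = v , itself refl (X⊆X∪A₂ x)
    ... | X-C (x , _) = v , itself refl (X⊆X∪A₂ x)
    ... | Y-A (_ , a) = v , itself refl (A⊆X∪A₂ a)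
    ... | Y-B y = let (x , xB , e) = mB-onto y in x , B-mate xB e
    ... | Y-C y = let (x , xC , e) = mC-onto y in x , C-mate xC e

    parts-differ : ∀ {q q′ u v} → part u ≡ q → part v ≡ q′ → q ≢ q′ → u ≢ v
    parts-differ pu pv q≢q′ refl = q≢q′ (trans (sym pu) pv)

    represents-unique : ∀ {x y v} → Represents x v → Represents y v → x ≡ y
    represents-unique (itself x≡v _)   (itself y≡v _)   = trans x≡v (sym y≡v)
    represents-unique (itself _ s)     (B-mate yB refl) = ⊥-elim (Y∉X∪A₂ (λ ()) (mB-∈ yB) s)
    represents-unique (itself _ s)     (C-mate yC refl) = ⊥-elim (Y∉X∪A₂ (λ ()) (mC-∈ yC) s)
    represents-unique (B-mate xB refl) (itself _ s)     = ⊥-elim (Y∉X∪A₂ (λ ()) (mB-∈ xB) s)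
    represents-unique (C-mate xC refl) (itself _ s)     = ⊥-elim (Y∉X∪A₂ (λ ()) (mC-∈ xC) s)
    represents-unique (B-mate xB e)    (B-mate yB e′)   = mB-injective xB yB (trans e (sym e′))
    represents-unique (C-mate xC e)    (C-mate yC e′)   = mC-injective xC yC (trans e (sym e′))
    represents-unique (B-mate xB e)    (C-mate yC e′)   =
      ⊥-elim (parts-differ (proj₂ (mB-∈ xB)) (proj₂ (mC-∈ yC)) (λ ()) (trans e (sym e′)))
    represents-unique (C-mate xC e)    (B-mate yB e′)   =
      ⊥-elim (parts-differ (proj₂ (mC-∈ xC)) (proj₂ (mB-∈ yB)) (λ ()) (trans e (sym e′)))

    represented-independent : ∀ {x u v} → Represents x u → Represents x v → ¬ Adj G u v
    represented-independent (itself refl _)  (itself refl _)  = ¬Adj-loop G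
    represented-independent (itself refl _)  (B-mate xB refl) = CoAdj⇒¬Adj G (mB-coAdj xB)
    represented-independent (itself refl _)  (C-mate xC refl) = CoAdj⇒¬Adj G (mC-coAdj xC)
    represented-independent (B-mate xB refl) (itself refl _)  = CoAdj⇒¬Adj G (mB-coAdj xB) ∘ adj-sym G
    represented-independent (C-mate xC refl) (itself refl _)  = CoAdj⇒¬Adj G (mC-coAdj xC) ∘ adj-sym G
    represented-independent (B-mate _ refl)  (B-mate _ refl)  = ¬Adj-loop G
    represented-independent (C-mate _ refl)  (C-mate _ refl)  = ¬Adj-loop G
    represented-independent (B-mate xB _)    (C-mate xC _)    =
      ⊥-elim (parts-differ (proj₂ xB) (proj₂ xC) (λ ()) refl)
    represented-independent (C-mate xC _)    (B-mate xB _)    =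
      ⊥-elim (parts-differ (proj₂ xC) (proj₂ xB) (λ ()) refl)

    rep : Fin (n G) → Fin (n G)
    rep v = proj₁ (represent v)

    rep-represents : ∀ v → Represents (rep v) v
    rep-represents v = proj₂ (represent v)

    represents⇒rep : ∀ {x v} → Represents x v → rep v ≡ x
    represents⇒rep = represents-unique (rep-represents _)

    rep-∈ : ∀ v → X∪A₂ (rep v) ≡ true
    rep-∈ v with rep v | rep-represents v
    ... | _ | itself refl s      = s
    ... | _ | B-mate (xX , _) _ = X⊆X∪A₂ xX
    ... | _ | C-mate (xX , _) _ = X⊆X∪A₂ xX

    rep-id : ∀ v → X∪A₂ v ≡ true → rep v ≡ v
    rep-id v s = represents⇒rep (itself refl s)

    rep-mB : ∀ {x} → X partB x → rep (mB x) ≡ x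
    rep-mB xB = represents⇒rep (B-mate xB refl)

    rep-mC : ∀ {x} → X partC x → rep (mC x) ≡ x
    rep-mC xC = represents⇒rep (C-mate xC refl)

    rep-independent : ∀ u v → rep u ≡ rep v → ¬ Adj G u v
    rep-independent u v e =
      represented-independent (rep-represents u) (subst (λ x → Represents x v) (sym e) (rep-represents v))

    Dominates : Fin (n G) → Fin (n G) → Set
    Dominates x d = ∀ y → X∪A₂ y ≡ true → y ≢ x → ∃ λ u → Adj G d u × rep u ≡ y

    dominates-from-X : ∀ {x} → inX x ≡ true → (∀ {y} → Y partA y → Adj G x y) → Dominates x x
    dominates-from-X xX A₂-adj y s y≢x with X∪A₂-elim s
    ... | inj₁ yX = y , clique _ _ (y≢x ∘ sym) (trans xX (sym yX)) , rep-id y s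
    ... | inj₂ yA = y , A₂-adj yA , rep-id y s

    dominates-from-Y : ∀ {x d} → Y partA d ⊎ Y partB d → rep d ≡ x → Dominates x d
    dominates-from-Y {x} {d} d∈A₂∪B₂ d↦x y s y≢x = neighbour (cell y)
      where
      Y-neighbour : ∀ {u} → inX u ≡ false → rep u ≡ y → ∃ λ u → Adj G d u × rep u ≡ y
      Y-neighbour {u} uY u↦y =
        u , clique d u (λ { refl → y≢x (trans (sym u↦y) d↦x) }) (trans ([ proj₁ , proj₁ ] d∈A₂∪B₂) (sym uY)) , u↦y

      neighbour : Cell y → ∃ λ u → Adj G d u × rep u ≡ y
      neighbour (X-A yA) = y , adj-sym G (A₁-adj y d yA d∈A₂∪B₂) , rep-id y s
      neighbour (X-B yB) = Y-neighbour (proj₁ (mB-∈ yB)) (rep-mB yB)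
      neighbour (X-C yC) = Y-neighbour (proj₁ (mC-∈ yC)) (rep-mC yC)
      neighbour (Y-A yA) = Y-neighbour (proj₁ yA) (rep-id y s)
      neighbour (Y-B yB) = ⊥-elim (Y∉X∪A₂ (λ ()) yB s)
      neighbour (Y-C yC) = ⊥-elim (Y∉X∪A₂ (λ ()) yC s)

    rep-dominated : ∀ x → X∪A₂ x ≡ true → ∃ λ d → rep d ≡ x × Dominates x d
    rep-dominated x s with cell x
    ... | X-A xA = x , rep-id x s , dominates-from-X (proj₁ xA) (λ yA → A₁-adj x _ xA (inj₁ yA))
    ... | X-C xC = x , rep-id x s , dominates-from-X (proj₁ xC) (λ yA → adj-sym G (A₂-adj _ x yA xC))
    ... | X-B xB = mB x , rep-mB xB , dominates-from-Y (inj₂ (mB-∈ xB)) (rep-mB xB)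
    ... | Y-A xA = x , rep-id x s , dominates-from-Y (inj₁ xA) (rep-id x s)
    ... | Y-B xB = ⊥-elim (Y∉X∪A₂ (λ ()) xB s)
    ... | Y-C xC = ⊥-elim (Y∉X∪A₂ (λ ()) xC s)

    coloring : HasBColoring G (count X∪A₂)
    coloring = fibres⇒HasBColoring G X∪A₂ rep rep-∈ rep-id rep-independent rep-dominated

InA⇒HasBColoring : ∀ G k → InA G k → HasBColoring G k
InA⇒HasBColoring G k (_ , inX , part , clique , A₁-adj , A₂-adj , PB , PC , k≡) =
  subst (HasBColoring G) (trans count-X∪A₂ (sym k≡)) (coloring clique A₁-adj A₂-adj PB PC)
  where
  open Partition inX part
  open 𝒜⇒BColoring G inX part

module BColoring⇒𝒜 (G : Graph) (bip : ComplementIsBipartite G) {b : ℕ}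
                   (c : Fin (n G) → Fin b) (isB : IsBColoring G b c) where

  side : Fin (n G) → Bool
  side = proj₁ bip

  bVertex : Fin b → Fin (n G)
  bVertex i = proj₁ (proj₂ (proj₂ isB) i)

  bVertex-colour : ∀ i → c (bVertex i) ≡ i
  bVertex-colour i = proj₁ (proj₂ (proj₂ (proj₂ isB) i))

  bVertex-adj : ∀ i j → j ≢ i → ∃ λ u → Adj G (bVertex i) u × c u ≡ j
  bVertex-adj i = proj₂ (proj₂ (proj₂ (proj₂ isB) i))

  clique : ∀ u v → u ≢ v → side u ≡ side v → Adj G u v
  clique u v u≢v s = ¬-not λ f → proj₂ bip u v (u≢v , f) s

  sameColour⇒CoAdj : ∀ {u v} → u ≢ v → c u ≡ c v → CoAdj G u v
  sameColour⇒CoAdj {u} {v} u≢v e = u≢v , ¬-not λ a → proj₁ isB u v a e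

  sameColour-sameSide : ∀ {u v} → c u ≡ c v → side u ≡ side v → u ≡ v
  sameColour-sameSide {u} {v} e s =
    decidable-stable (u ≟ v) λ u≢v → proj₂ bip u v (sameColour⇒CoAdj u≢v e) s

  Partner : Fin (n G) → Set
  Partner v = ∃ λ u → u ≢ v × c u ≡ c v

  partner? : ∀ v → Dec (Partner v)
  partner? v = any? λ u → ¬? (u ≟ v) ×-dec (c u ≟ c v)

  Partner-resp-colour : ∀ {u v} → c u ≡ c v → Partner u → Partner v
  Partner-resp-colour {u} {v} e (w , w≢u , cw) with w ≟ v
  ... | yes refl = u , (λ { refl → w≢u refl }) , e
  ... | no w≢v   = w , w≢v , trans cw e

  partOfSide : Bool → Part
  partOfSide true  = partC
  partOfSide false = partB

  partOfSide-injective : ∀ {s t} → partOfSide s ≡ partOfSide t → s ≡ t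
  partOfSide-injective {true}  {true}  _ = refl
  partOfSide-injective {false} {false} _ = refl

  partOfSide≢partA : ∀ s → partOfSide s ≢ partA
  partOfSide≢partA true  ()
  partOfSide≢partA false ()

  part : Fin (n G) → Part
  part v with partner? v
  ... | yes _ = partOfSide (side (bVertex (c v)))
  ... | no _  = partA

  mate : Fin (n G) → Fin (n G)
  mate v with partner? v
  ... | yes (u , _) = u
  ... | no _        = v

  part-resp-colour : ∀ {u v} → c u ≡ c v → part u ≡ part v
  part-resp-colour {u} {v} e with partner? u | partner? v
  ... | yes _   | yes _   = cong (partOfSide ∘ side ∘ bVertex) e
  ... | no _    | no _    = refl
  ... | yes pu  | no ¬pv  = ⊥-elim (¬pv (Partner-resp-colour e pu))
  ... | no ¬pu  | yes pv  = ⊥-elim (¬pu (Partner-resp-colour (sym e) pv))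

  mate-colour : ∀ v → c (mate v) ≡ c v
  mate-colour v with partner? v
  ... | yes (_ , _ , e) = e
  ... | no _            = refl

  part-mate : ∀ v → part (mate v) ≡ part v
  part-mate v = part-resp-colour (mate-colour v)

  part-side : ∀ {v} s → part v ≡ partOfSide s → side (bVertex (c v)) ≡ s
  part-side {v} s e with partner? v
  ... | yes _ = partOfSide-injective e
  ... | no _  = ⊥-elim (partOfSide≢partA s (sym e))

  mate-side : ∀ {v} → part v ≢ partA → side (mate v) ≢ side v
  mate-side {v} v∉A s with partner? v
  ... | yes (u , u≢v , e) = u≢v (sameColour-sameSide e s)
  ... | no _              = v∉A refl

  A-alone : ∀ {u v} → part v ≡ partA → c u ≡ c v → u ≡ v
  A-alone {u} {v} vA e with partner? v
  ... | no ¬pv = decidable-stable (u ≟ v) λ u≢v → ¬pv (u , u≢v , e)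
  ... | yes _  = ⊥-elim (partOfSide≢partA _ vA)

  bVertex-on-own-side : ∀ v → side (bVertex (c v)) ≡ side v → bVertex (c v) ≡ v
  bVertex-on-own-side v = sameColour-sameSide (bVertex-colour (c v))

  bVertex-adj-A : ∀ {u v} → part u ≡ partA → u ≢ v → bVertex (c v) ≡ v → Adj G v u
  bVertex-adj-A {u} {v} uA u≢v v-bVertex =
    let (w , a , cw) = bVertex-adj (c v) (c u) (λ e → u≢v (sym (A-alone uA (sym e))))
    in subst₂ (Adj G) v-bVertex (A-alone uA cw) a

  open Partition side part

  sides-differ : ∀ {u v} → side u ≡ true → side v ≡ false → u ≢ v
  sides-differ uX vY refl with () ← trans (sym uX) vY

  A₁-adj : ∀ u v → X partA u → (Y partA v ⊎ Y partB v) → Adj G u v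
  A₁-adj u v (uX , uA) (inj₁ (vY , vA)) =
    bVertex-adj-A vA (sides-differ uX vY ∘ sym) (A-alone uA (bVertex-colour (c u)))
  A₁-adj u v (uX , uA) (inj₂ (vY , vB)) =
    adj-sym G (bVertex-adj-A uA (sides-differ uX vY) (bVertex-on-own-side v (trans (part-side false vB) (sym vY))))

  A₂-adj : ∀ u v → Y partA u → X partC v → Adj G u v
  A₂-adj u v (uY , uA) (vX , vC) =
    adj-sym G (bVertex-adj-A uA (sides-differ vX uY ∘ sym) (bVertex-on-own-side v (trans (part-side true vC) (sym vX))))

  mate-opposite : ∀ {v s} → part v ≢ partA → side v ≡ s → side (mate v) ≡ not s
  mate-opposite v∉A refl = ¬-not (mate-side v∉A)

  antimatching : ∀ s → PerfectAntimatching G (X (partOfSide s)) (Y (partOfSide s))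
  antimatching s = mate , mate-∈ , mate-injective , mate-onto
    where
    not-A : ∀ {v} → part v ≡ partOfSide s → part v ≢ partA
    not-A e e′ = partOfSide≢partA s (trans (sym e) e′)

    mate-∈ : ∀ x → X (partOfSide s) x → Y (partOfSide s) (mate x) × CoAdj G x (mate x)
    mate-∈ x (xX , xq) =
      (mate-opposite (not-A xq) xX , trans (part-mate x) xq) ,
      sameColour⇒CoAdj (λ x≡m → mate-side (not-A xq) (cong side (sym x≡m))) (sym (mate-colour x))

    mate-injective : ∀ x x′ → X (partOfSide s) x → X (partOfSide s) x′ → mate x ≡ mate x′ → x ≡ x′
    mate-injective x x′ (xX , _) (x′X , _) e =
      sameColour-sameSide (trans (sym (mate-colour x)) (trans (cong c e) (mate-colour x′))) (trans xX (sym x′X))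

    mate-onto : ∀ y → Y (partOfSide s) y → ∃ λ x → X (partOfSide s) x × mate x ≡ y
    mate-onto y (yY , yq) = mate y , (myX , myq) ,
      sameColour-sameSide (trans (mate-colour (mate y)) (mate-colour y))
                          (trans (mate-opposite (not-A myq) myX) (sym yY))
      where
      myX : side (mate y) ≡ true
      myX = mate-opposite (not-A yq) yY
      myq : part (mate y) ≡ partOfSide s
      myq = trans (part-mate y) yq

  X∪A₂-representative : ∀ v → ∃ λ u → X∪A₂ u ≡ true × c u ≡ c v
  X∪A₂-representative v with X∪A₂ v in e
  ... | true  = v , e , refl
  ... | false = let (vY , v∉A) = X∪A₂-false e in
                mate v , X⊆X∪A₂ (mate-opposite v∉A vY) , mate-colour v

  colour-injective : ∀ {u v} → X∪A₂ u ≡ true → X∪A₂ v ≡ true → c u ≡ c v → u ≡ v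
  colour-injective su sv e with X∪A₂-elim su | X∪A₂-elim sv
  ... | inj₂ (_ , uA) | _             = sym (A-alone uA (sym e))
  ... | inj₁ _        | inj₂ (_ , vA) = A-alone vA e
  ... | inj₁ uX       | inj₁ vX       = sameColour-sameSide e (trans uX (sym vX))

  count-X∪A₂≡b : count X∪A₂ ≡ b
  count-X∪A₂≡b = count-bijection X∪A₂ c colour-injective λ j →
    let (u , s , e) = X∪A₂-representative (bVertex j) in u , s , trans e (bVertex-colour j)

  inA : InA G b
  inA = bip , side , part , clique , A₁-adj , A₂-adj , antimatching false , antimatching true ,
        trans (sym count-X∪A₂≡b) count-X∪A₂

HasBColoring⇒InA : ∀ G → ComplementIsBipartite G → ∀ k → HasBColoring G k → InA G k
HasBColoring⇒InA G bip k (c , isB) = BColoring⇒𝒜.inA G bip c isB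

corollary3 : (G : Graph) → ComplementIsBipartite G → (b : ℕ) → 1 ≤ b →
    BChromaticNumberIs G b ⇔ (InA G b × (∀ k → InA G k → k ≤ b))
corollary3 G bip b _ = mk⇔
  (λ (has-b , maximal) → HasBColoring⇒InA G bip b has-b , λ k inA-k → maximal k (InA⇒HasBColoring G k inA-k))
  (λ (inA-b , maximal) → InA⇒HasBColoring G b inA-b , λ k has-k → maximal k (HasBColoring⇒InA G bip k has-k))
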